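{- Let $\ell \ge 1$ be an integer. Every graph $G$ contains either $\ell$ pairwise vertex-disjoint induced copies of $K_{\ell,\ell}$ with no edges of $G$ between any two of them, or an induced subgraph $H$ with $\chi(H) \ge \chi(G)/(2\ell^2) - 1$ such that either $\omega(H) < \omega(G)$ or $H$ contains no induced copy of $K_{\ell,\ell}$.
   Context: All graphs are finite and simple. $\chi$ denotes chromatic number and $\omega$ clique number. -}

module Defs where

open import Data.Nat using (ℕ; _≤_; _<_; _*_; _+_; suc)
open import Data.Fin using (Fin)
open import Data.Bool using (Bool; true; false)
open import Data.Sum using (_⊎_)
open import Data.Product using (Σ; _×_; ∃-syntax)
open import Relation.Binary.PropositionalEquality using (_≡_; _≢_)
open import Relation.Nullary using (¬_)
open import Function.Definitions using (Injective)

record Graph (n : ℕ) : Set where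
  field
    adj    : Fin n → Fin n → Bool
    sym    : ∀ x y → adj x y ≡ adj y x
    irrefl : ∀ x → adj x x ≡ false

open Graph public

Edge : ∀ {n} → Graph n → Fin n → Fin n → Set
Edge G x y = adj G x y ≡ true

Colorable : ∀ {n} → Graph n → ℕ → Set
Colorable {n} G k = Σ (Fin n → Fin k) λ c → ∀ x y → Edge G x y → c x ≢ c y

IsChromaticNumber : ∀ {n} → Graph n → ℕ → Set
IsChromaticNumber G c = Colorable G c × (∀ k → Colorable G k → c ≤ k)

HasClique : ∀ {n} → Graph n → ℕ → Set
HasClique {n} G k = Σ (Fin k → Fin n) λ f →
  Injective _≡_ _≡_ f × (∀ i j → i ≢ j → Edge G (f i) (f j))

IsCliqueNumber : ∀ {n} → Graph n → ℕ → Set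
IsCliqueNumber G w = HasClique G w × (∀ k → HasClique G k → k ≤ w)

-- Induced subgraph on the image of an (injective) map Fin m → Fin n.
induced : ∀ {n m} → Graph n → (Fin m → Fin n) → Graph m
induced G f = record
  { adj    = λ x y → adj G (f x) (f y)
  ; sym    = λ x y → sym G (f x) (f y)
  ; irrefl = λ x → irrefl G (f x)
  }

IsInducedKll : ∀ {n} → Graph n → (ℓ : ℕ) → (Fin ℓ ⊎ Fin ℓ → Fin n) → Set
IsInducedKll G ℓ a =
  Injective _≡_ _≡_ a
  × (∀ i j → Edge G (a (Data.Sum.inj₁ i)) (a (Data.Sum.inj₂ j)))
  × (∀ i j → ¬ Edge G (a (Data.Sum.inj₁ i)) (a (Data.Sum.inj₁ j)))
  × (∀ i j → ¬ Edge G (a (Data.Sum.inj₂ i)) (a (Data.Sum.inj₂ j)))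

HasInducedKll : ∀ {n} → Graph n → ℕ → Set
HasInducedKll {n} G ℓ = Σ (Fin ℓ ⊎ Fin ℓ → Fin n) λ a → IsInducedKll G ℓ a

HasSeparatedKlls : ∀ {n} → Graph n → ℕ → Set
HasSeparatedKlls {n} G ℓ =
  Σ (Fin ℓ → Fin ℓ ⊎ Fin ℓ → Fin n) λ copy →
    (∀ k → IsInducedKll G ℓ (copy k))
    × (∀ k k' → k ≢ k' → ∀ x y →
         (copy k x ≢ copy k' y) × ¬ Edge G (copy k x) (copy k' y))

-- Collect pairwise separated induced copies of K_{ℓ,ℓ} greedily.  After i < ℓ copies, let R be
-- the set of vertices outside the closed neighbourhoods of the 2ℓi vertices used so far; a copy
-- inside R is separated from all earlier ones.  If G[R] contains none, colour G by a colouring of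
-- G[R] together with, for each used vertex v, a fresh colour for v and fresh colours for G[N(v)].
-- With K the largest χ(G[N(v)]) this gives χ(G) ≤ χ(G[R]) + 2ℓi(K + 1) ≤ 2ℓ²(M + 1), where
-- M = max(χ(G[R]), K) is the chromatic number either of G[R], which has no induced K_{ℓ,ℓ}, or of
-- some G[N(v)], whose clique number is below ω(G) since v extends each of its cliques.

module Submission where

open import Defs
open import Data.Nat using (ℕ; zero; suc; _≤_; _<_; _*_; _+_; _≤?_)
open import Data.Nat.Induction using (<-rec)
open import Data.Nat.Properties
  using (≤-refl; ≤-trans; <-trans; <⇒≤; ≰⇒>; ≮⇒≥; ≤∧≢⇒<; m<1+n⇒m≤n; m≤n⇒m≤1+n; m≤m+n; m≤n*m;
         +-monoˡ-≤; *-monoˡ-≤; anyUpTo?; module ≤-Reasoning)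
open import Data.Nat.Solver using (module +-*-Solver)
open import Data.Fin using (Fin; zero; suc; join; splitAt; combine; remQuot; inject≤)
open import Data.Fin.Properties
  using (_≟_; any?; all?; suc-injective; injective⇒≤; inject≤-injective; splitAt-join; remQuot-combine)
open import Data.Vec.Functional using (_∷_)
open import Data.Vec.Functional.Properties using (∷-cong)
open import Data.Bool using (true)
import Data.Bool.Properties as Bool
open import Data.Sum using (_⊎_; inj₁; inj₂; [_,_]; [_,_]′)
import Data.Sum as Sum
open import Data.Sum.Properties using (≡-dec; inj₁-injective; inj₂-injective)
open import Data.Product using (Σ; _×_; _,_; proj₁; proj₂; ∃; ∃-syntax)
open import Data.Product.Properties using (,-injective)
open import Data.Unit using (tt)
open import Function using (_∘_)
open import Function.Definitions using (Injective)
open import Level using (0ℓ)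
open import Relation.Binary.Definitions using (DecidableEquality; _Respects_)
open import Relation.Binary.PropositionalEquality
  using (_≡_; _≢_; _≗_; refl; trans; cong; subst; subst₂; ≢-sym) renaming (sym to ≡-sym)
open import Relation.Nullary using (¬_; Dec; yes; no; contradiction)
open import Relation.Nullary.Decidable using (map′; ¬?; _×-dec_; _⊎-dec_; _→-dec_; toSum)
open import Relation.Unary using (Pred; Decidable; _∪_; ⋃; ∁; ｛_｝; U; _⊆_; _∉_)
open import Relation.Unary.Properties using (_∪?_; ∁?)

private
  variable
    a b i k m n ℓ : ℕ

edge? : (G : Graph n) → ∀ x y → Dec (Edge G x y)
edge? G x y = adj G x y Bool.≟ true

edge-sym : (G : Graph n) → ∀ {x y} → Edge G x y → Edge G y x
edge-sym G {x} {y} = trans (sym G y x)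

edge-irrefl : (G : Graph n) → ∀ {x} → ¬ Edge G x x
edge-irrefl G {x} e = contradiction (trans (≡-sym e) (irrefl G x)) λ ()

edge-resp : (G : Graph n) → ∀ {x x′ y y′} → x ≡ x′ → y ≡ y′ → Edge G x y → Edge G x′ y′
edge-resp G = subst₂ (Edge G)

injective-resp : {A B : Set} {f g : A → B} → f ≗ g → Injective _≡_ _≡_ f → Injective _≡_ _≡_ g
injective-resp f≗g f-inj {x} {y} eq = f-inj (trans (f≗g x) (trans eq (≡-sym (f≗g y))))

-- Without function extensionality, f and head f ∷ tail f are only pointwise equal; hence P Respects _≗_.
∃-function? : ∀ p {P : Pred (Fin p → Fin k) 0ℓ} → P Respects _≗_ → Decidable P → Dec (∃ P)
∃-function? zero resp P? = map′ (empty ,_) (λ (f , q) → resp (λ ()) q) (P? empty)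
  where
  empty : Fin 0 → Fin _
  empty ()
∃-function? (suc p) resp P? =
  map′ (λ (c , f , q) → c ∷ f , q)
       (λ (f , q) → f zero , f ∘ suc , resp (∷-cong refl λ _ → refl) q)
       (any? λ c → ∃-function? p (resp ∘ ∷-cong refl) (P? ∘ (c ∷_)))

∃-⊎-function? : ∀ a b {P : Pred (Fin a ⊎ Fin b → Fin k) 0ℓ} → P Respects _≗_ → Decidable P → Dec (∃ P)
∃-⊎-function? a b resp P? =
  map′ (λ (l , r , q) → [ l , r ]′ , q)
       (λ (f , q) → f ∘ inj₁ , f ∘ inj₂ , resp [ (λ _ → refl) , (λ _ → refl) ] q)
       (∃-function? a (λ l≗l′ (r , q) → r , resp [ l≗l′ , (λ _ → refl) ] q) λ l →
          ∃-function? b (λ r≗r′ → resp [ (λ _ → refl) , r≗r′ ]) λ r → P? [ l , r ]′)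

all⊎? : {P : Pred (Fin a ⊎ Fin b) 0ℓ} → Decidable P → Dec (∀ x → P x)
all⊎? P? =
  map′ (λ (l , r) → [ l , r ]) (λ h → h ∘ inj₁ , h ∘ inj₂) (all? (P? ∘ inj₁) ×-dec all? (P? ∘ inj₂))

⋃-⊎? : {A : Set} {S : Fin a ⊎ Fin b → Pred A 0ℓ} → (∀ j → Decidable (S j)) → Decidable (⋃ (Fin a ⊎ Fin b) S)
⋃-⊎? S? x =
  map′ [ (λ (j , s) → inj₁ j , s) , (λ (j , s) → inj₂ j , s) ]′
       (λ { (inj₁ j , s) → inj₁ (j , s) ; (inj₂ j , s) → inj₂ (j , s) })
       (any? (λ j → S? (inj₁ j) x) ⊎-dec any? (λ j → S? (inj₂ j) x))

injective? : {A : Set} → (∀ {P : Pred A 0ℓ} → Decidable P → Dec (∀ x → P x)) → DecidableEquality A →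
             (f : A → Fin n) → Dec (Injective _≡_ _≡_ f)
injective? all?ᴬ _≟ᴬ_ f =
  map′ (λ h {x} {y} → h x y) (λ f-inj _ _ → f-inj) (all?ᴬ λ x → all?ᴬ λ y → (f x ≟ f y) →-dec (x ≟ᴬ y))

colorable? : (G : Graph n) → ∀ k → Dec (Colorable G k)
colorable? {n} G k = ∃-function? n resp λ c → all? λ x → all? λ y → edge? G x y →-dec ¬? (c x ≟ c y)
  where
  resp : (λ c → ∀ x y → Edge G x y → c x ≢ c y) Respects _≗_
  resp c≗d proper x y e eq = proper x y e (trans (c≗d x) (trans eq (≡-sym (c≗d y))))

hasClique? : (G : Graph n) → ∀ k → Dec (HasClique G k)
hasClique? G k =
  ∃-function? k resp λ f → injective? all? _≟_ f ×-dec all? λ i → all? λ j → ¬? (i ≟ j) →-dec edge? G (f i) (f j)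
  where
  resp : (λ f → Injective _≡_ _≡_ f × (∀ i j → i ≢ j → Edge G (f i) (f j))) Respects _≗_
  resp f≗g (f-inj , clique) = injective-resp f≗g f-inj , λ i j i≢j → edge-resp G (f≗g i) (f≗g j) (clique i j i≢j)

isInducedKll-resp : (G : Graph n) → ∀ ℓ → IsInducedKll G ℓ Respects _≗_
isInducedKll-resp G ℓ a≗b (a-inj , across , left , right) =
  injective-resp a≗b a-inj ,
  (λ i j → edge-resp G (a≗b _) (a≗b _) (across i j)) ,
  (λ i j → left i j ∘ edge-resp G (≡-sym (a≗b _)) (≡-sym (a≗b _))) ,
  (λ i j → right i j ∘ edge-resp G (≡-sym (a≗b _)) (≡-sym (a≗b _)))

isInducedKll? : (G : Graph n) → ∀ ℓ a → Dec (IsInducedKll G ℓ a)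
isInducedKll? G ℓ a =
  injective? all⊎? (≡-dec _≟_ _≟_) a
  ×-dec all? (λ i → all? λ j → edge? G (a (inj₁ i)) (a (inj₂ j)))
  ×-dec all? (λ i → all? λ j → ¬? (edge? G (a (inj₁ i)) (a (inj₁ j))))
  ×-dec all? (λ i → all? λ j → ¬? (edge? G (a (inj₂ i)) (a (inj₂ j))))

hasInducedKll? : (G : Graph n) → ∀ ℓ → Dec (HasInducedKll G ℓ)
hasInducedKll? G ℓ = ∃-⊎-function? ℓ ℓ (isInducedKll-resp G ℓ) (isInducedKll? G ℓ)

Least Greatest : Pred ℕ 0ℓ → Set
Least Q = Σ ℕ λ k → Q k × (∀ j → Q j → k ≤ j)
Greatest Q = Σ ℕ λ k → Q k × (∀ j → Q j → j ≤ k)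

least : {Q : Pred ℕ 0ℓ} → Decidable Q → ∀ {N} → Q N → Least Q
least {Q} Q? {N} = <-rec (λ N → Q N → Least Q) search N
  where
  search : ∀ N → (∀ {j} → j < N → Q j → Least Q) → Q N → Least Q
  search N smaller qN with anyUpTo? Q? N
  ... | yes (j , j<N , qj) = smaller j<N qj
  ... | no none = N , qN , λ j qj → ≮⇒≥ λ j<N → none (j , j<N , qj)

greatest : {Q : Pred ℕ 0ℓ} → Decidable Q → Q 0 → ∀ N → (∀ k → Q k → k ≤ N) → Greatest Q
greatest Q? q₀ N bounded with Q? N
... | yes qN = N , qN , bounded
greatest Q? q₀ zero    bounded | no ¬q₀ = contradiction q₀ ¬q₀
greatest Q? q₀ (suc N) bounded | no ¬qN =
  greatest Q? q₀ N λ k qk → m<1+n⇒m≤n (≤∧≢⇒< (bounded k qk) λ { refl → ¬qN qk })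

chromaticNumber : (G : Graph n) → Σ ℕ (IsChromaticNumber G)
chromaticNumber G = least (colorable? G) identityColoring
  where
  identityColoring : Colorable G _
  identityColoring = (λ x → x) , λ x y e x≡y → edge-irrefl G (subst (Edge G x) (≡-sym x≡y) e)

cliqueNumber : (G : Graph n) → Σ ℕ (IsCliqueNumber G)
cliqueNumber {n} G = greatest (hasClique? G) ((λ ()) , (λ { {()} }) , λ ()) n λ k (_ , f-inj , _) → injective⇒≤ f-inj

record Enumeration {n} (S : Pred (Fin n) 0ℓ) : Set where
  field
    size           : ℕ
    elem           : Fin size → Fin n
    elem-injective : Injective _≡_ _≡_ elem
    elem∈          : ∀ i → S (elem i)
    index          : ∀ {x} → S x → Fin size
    elem-index     : ∀ {x} (s : S x) → elem (index s) ≡ x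

open Enumeration

enumerate : {S : Pred (Fin n) 0ℓ} → Decidable S → Enumeration S
enumerate {zero} S? = record
  { size = 0 ; elem = λ () ; elem-injective = λ { {()} } ; elem∈ = λ ()
  ; index = λ { {()} } ; elem-index = λ { {()} } }
enumerate {suc n} S? with S? zero
... | yes s₀ = record
  { size = suc (size E) ; elem = zero ∷ suc ∘ elem E ; elem-injective = elem-inj
  ; elem∈ = λ { zero → s₀ ; (suc i) → elem∈ E i }
  ; index = λ { {zero} _ → zero ; {suc x} s → suc (index E s) }
  ; elem-index = λ { {zero} _ → refl ; {suc x} s → cong suc (elem-index E s) } }
  where
  E = enumerate (S? ∘ suc)
  elem-inj : Injective _≡_ _≡_ (zero ∷ suc ∘ elem E)
  elem-inj {zero}  {zero}  _  = refl
  elem-inj {suc i} {suc j} eq = cong suc (elem-injective E (suc-injective eq))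
  elem-inj {zero}  {suc _} ()
  elem-inj {suc _} {zero}  ()
... | no ¬s₀ = record
  { size = size E ; elem = suc ∘ elem E ; elem-injective = elem-injective E ∘ suc-injective
  ; elem∈ = elem∈ E
  ; index = λ { {zero} s → contradiction s ¬s₀ ; {suc x} s → index E s }
  ; elem-index = λ { {zero} s → contradiction s ¬s₀ ; {suc x} s → cong suc (elem-index E s) } }
  where
  E = enumerate (S? ∘ suc)

-- The colour of x may depend on the proof of S x, so unions are colourable without deciding membership.
ColorableOn : Graph n → Pred (Fin n) 0ℓ → ℕ → Set
ColorableOn {n} G S k =
  Σ (∀ x → S x → Fin k) λ c → ∀ {x y} (p : S x) (q : S y) → Edge G x y → c x p ≢ c y q

module _ (G : Graph n) where

  colorableOn-⊆ : {S T : Pred (Fin n) 0ℓ} → T ⊆ S → ColorableOn G S k → ColorableOn G T k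
  colorableOn-⊆ T⊆S (c , proper) = (λ x t → c x (T⊆S t)) , λ p q → proper (T⊆S p) (T⊆S q)

  colorableOn-≤ : {S : Pred (Fin n) 0ℓ} → a ≤ b → ColorableOn G S a → ColorableOn G S b
  colorableOn-≤ a≤b (c , proper) =
    (λ x s → inject≤ (c x s) a≤b) , λ p q e → proper p q e ∘ inject≤-injective a≤b a≤b _ _

  colorableOn-｛｝ : ∀ v → ColorableOn G ｛ v ｝ 1
  colorableOn-｛｝ v = (λ _ _ → zero) , λ { refl refl e _ → edge-irrefl G e }

  colorableOn-∪ : {S T : Pred (Fin n) 0ℓ} → ColorableOn G S a → ColorableOn G T b → ColorableOn G (S ∪ T) (a + b)
  colorableOn-∪ {a} {b} {S} {T} (c , proper) (d , proper′) =
    (λ x → join a b ∘ colour x) , λ p q e → distinct p q e ∘ join-injective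
    where
    colour : ∀ x → (S ∪ T) x → Fin a ⊎ Fin b
    colour x = Sum.map (c x) (d x)
    join-injective : ∀ {u v} → join a b u ≡ join a b v → u ≡ v
    join-injective {u} {v} eq = trans (≡-sym (splitAt-join a b u)) (trans (cong (splitAt a) eq) (splitAt-join a b v))
    distinct : ∀ {x y} (p : (S ∪ T) x) (q : (S ∪ T) y) → Edge G x y → colour x p ≢ colour y q
    distinct (inj₁ s) (inj₁ s′) e = proper s s′ e ∘ inj₁-injective
    distinct (inj₂ t) (inj₂ t′) e = proper′ t t′ e ∘ inj₂-injective
    distinct (inj₁ _) (inj₂ _) _ ()
    distinct (inj₂ _) (inj₁ _) _ ()

  colorableOn-⋃ : {S : Fin a → Pred (Fin n) 0ℓ} → (∀ j → ColorableOn G (S j) k) → ColorableOn G (⋃ (Fin a) S) (a * k)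
  colorableOn-⋃ {a} {k} {S} c = (λ x (j , s) → combine j (proj₁ (c j) x s)) , distinct
    where
    combine-injective : ∀ {j j′ : Fin a} {u v : Fin k} → combine j u ≡ combine j′ v → (j , u) ≡ (j′ , v)
    combine-injective {j} {j′} {u} {v} eq =
      trans (≡-sym (remQuot-combine j u)) (trans (cong (remQuot k) eq) (remQuot-combine j′ v))
    distinct : ∀ {x y} (p : ⋃ (Fin a) S x) (q : ⋃ (Fin a) S y) → Edge G x y →
               combine (proj₁ p) (proj₁ (c _) x (proj₂ p)) ≢ combine (proj₁ q) (proj₁ (c _) y (proj₂ q))
    distinct (j , s) (j′ , s′) e eq with ,-injective (combine-injective eq)
    ... | refl , same = proj₂ (c j) s s′ e same

  colorableOn-⋃⊎ : {S : Fin a ⊎ Fin b → Pred (Fin n) 0ℓ} → (∀ j → ColorableOn G (S j) k) →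
                   ColorableOn G (⋃ (Fin a ⊎ Fin b) S) (a * k + b * k)
  colorableOn-⋃⊎ {a} {b} {S = S} c =
    colorableOn-⊆ split (colorableOn-∪ (colorableOn-⋃ (c ∘ inj₁)) (colorableOn-⋃ (c ∘ inj₂)))
    where
    split : ⋃ (Fin a ⊎ Fin b) S ⊆ ⋃ (Fin a) (S ∘ inj₁) ∪ ⋃ (Fin b) (S ∘ inj₂)
    split = λ { (inj₁ j , s) → inj₁ (j , s) ; (inj₂ j , s) → inj₂ (j , s) }

  colorableOn-enumeration : {S : Pred (Fin n) 0ℓ} (E : Enumeration S) → Colorable (induced G (elem E)) k → ColorableOn G S k
  colorableOn-enumeration E (c , proper) =
    (λ x s → c (index E s)) ,
    λ s t e → proper (index E s) (index E t) (edge-resp G (≡-sym (elem-index E s)) (≡-sym (elem-index E t)) e)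

  colorableOn-U⇒colorable : ColorableOn G U k → Colorable G k
  colorableOn-U⇒colorable (c , proper) = (λ x → c x tt) , λ x y → proper tt tt

  colorable-∁∪ : {S : Pred (Fin n) 0ℓ} → Decidable S → ColorableOn G (∁ S) a → ColorableOn G S b → Colorable G (a + b)
  colorable-∁∪ {S = S} S? c d = colorableOn-U⇒colorable (colorableOn-⊆ cover (colorableOn-∪ c d))
    where
    cover : U ⊆ ∁ S ∪ S
    cover {x} _ = Sum.swap (toSum (S? x))

Nbhd ClosedNbhd : Graph n → Fin n → Pred (Fin n) 0ℓ
Nbhd G v = Edge G v
ClosedNbhd G v = ｛ v ｝ ∪ Nbhd G v

colorableOn-closedNbhd : (G : Graph n) → ∀ {v} → ColorableOn G (Nbhd G v) k → ColorableOn G (ClosedNbhd G v) (suc k)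
colorableOn-closedNbhd G {v} = colorableOn-∪ G (colorableOn-｛｝ G v)

hasClique-cone : (G : Graph n) {v : Fin n} (f : Fin m → Fin n) → Injective _≡_ _≡_ f → (∀ i → Nbhd G v (f i)) →
                 HasClique (induced G f) k → HasClique G (suc k)
hasClique-cone G {v} f f-inj f⊆N (h , h-inj , clique) = v ∷ f ∘ h , cone-inj , cone-clique
  where
  v≢f : ∀ i → v ≢ f i
  v≢f i eq = edge-irrefl G (subst (Edge G v) (≡-sym eq) (f⊆N i))
  cone-inj : Injective _≡_ _≡_ (v ∷ f ∘ h)
  cone-inj {zero}  {zero}  _  = refl
  cone-inj {zero}  {suc j} eq = contradiction eq (v≢f (h j))
  cone-inj {suc i} {zero}  eq = contradiction (≡-sym eq) (v≢f (h i))
  cone-inj {suc i} {suc j} eq = cong suc (h-inj (f-inj eq))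
  cone-clique : ∀ i j → i ≢ j → Edge G ((v ∷ f ∘ h) i) ((v ∷ f ∘ h) j)
  cone-clique zero    zero    0≢0 = contradiction refl 0≢0
  cone-clique zero    (suc j) _   = f⊆N (h j)
  cone-clique (suc i) zero    _   = edge-sym G (f⊆N (h i))
  cone-clique (suc i) (suc j) i≢j = clique i j (i≢j ∘ cong suc)

cliqueNumber-nbhd< : (G : Graph n) → ∀ {v ω ωH} → IsCliqueNumber G ω → (E : Enumeration (Nbhd G v)) →
                     IsCliqueNumber (induced G (elem E)) ωH → ωH < ω
cliqueNumber-nbhd< G (_ , maximal) E (clique , _) =
  maximal _ (hasClique-cone G (elem E) (elem-injective E) (elem∈ E) clique)

-- Separated induced copies of K_{ℓ,ℓ}

Side : ℕ → Set
Side ℓ = Fin ℓ ⊎ Fin ℓ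

Apart : Graph n → Fin n → Fin n → Set
Apart G u v = u ≢ v × ¬ Edge G u v

apart-sym : (G : Graph n) → ∀ {u v} → Apart G u v → Apart G v u
apart-sym G (u≢v , ¬uv) = ≢-sym u≢v , ¬uv ∘ edge-sym G

SeparatedKlls : Graph n → (ℓ i : ℕ) → Set
SeparatedKlls {n} G ℓ i =
  Σ (Fin i → Side ℓ → Fin n) λ copy →
    (∀ k → IsInducedKll G ℓ (copy k)) × (∀ k k′ → k ≢ k′ → ∀ x y → Apart G (copy k x) (copy k′ y))

Covered : Graph n → (Fin i → Side ℓ → Fin n) → Pred (Fin n) 0ℓ
Covered {ℓ = ℓ} G copy = ⋃ (Fin _) λ k → ⋃ (Side ℓ) λ z → ClosedNbhd G (copy k z)

covered? : (G : Graph n) (copy : Fin i → Side ℓ → Fin n) → Decidable (Covered G copy)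
covered? G copy x = any? λ k → ⋃-⊎? (λ z → (copy k z ≟_) ∪? edge? G (copy k z)) x

∉-covered⇒apart : (G : Graph n) {copy : Fin i → Side ℓ → Fin n} → ∀ {x} → x ∉ Covered G copy →
                  ∀ k z → Apart G (copy k z) x
∉-covered⇒apart G x∉ k z = (λ eq → x∉ (k , z , inj₁ eq)) , (λ e → x∉ (k , z , inj₂ e))

isInducedKll-induced : (G : Graph n) {f : Fin m → Fin n} {a : Side ℓ → Fin m} →
                       Injective _≡_ _≡_ f → IsInducedKll (induced G f) ℓ a → IsInducedKll G ℓ (f ∘ a)
isInducedKll-induced G f-inj (a-inj , edges) = a-inj ∘ f-inj , edges

separatedKlls-extend : (G : Graph n) ((copy , _) : SeparatedKlls G ℓ i) {a : Side ℓ → Fin n} →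
                       IsInducedKll G ℓ a → (∀ z → a z ∉ Covered G copy) → SeparatedKlls G ℓ (suc i)
separatedKlls-extend G (copy , kll , apart) {a} a-kll a-remote = a ∷ copy , kll′ , apart′
  where
  kll′ : ∀ k → IsInducedKll G _ ((a ∷ copy) k)
  kll′ zero    = a-kll
  kll′ (suc k) = kll k
  apart′ : ∀ k k′ → k ≢ k′ → ∀ x y → Apart G ((a ∷ copy) k x) ((a ∷ copy) k′ y)
  apart′ zero    zero     0≢0  = contradiction refl 0≢0
  apart′ zero    (suc k′) _    x y = apart-sym G (∉-covered⇒apart G (a-remote x) k′ y)
  apart′ (suc k) zero     _    x y = ∉-covered⇒apart G (a-remote y) k x
  apart′ (suc k) (suc k′) k≢k′ = apart k k′ (k≢k′ ∘ cong suc)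

-- The greedy construction

bounded⊎argmax : (g : Fin n → ℕ) → ∀ b → (∀ x → g x ≤ b) ⊎ ∃[ v ] b < g v × (∀ x → g x ≤ g v)
bounded⊎argmax {zero} g b = inj₁ λ ()
bounded⊎argmax {suc n} g b with bounded⊎argmax (g ∘ suc) b
... | inj₁ bounded with g zero ≤? b
...   | yes g₀≤b = inj₁ λ { zero → g₀≤b ; (suc x) → bounded x }
...   | no g₀≰b  =
  inj₂ (zero , ≰⇒> g₀≰b , λ { zero → ≤-refl ; (suc x) → ≤-trans (bounded x) (<⇒≤ (≰⇒> g₀≰b)) })
bounded⊎argmax {suc n} g b | inj₂ (v , b<gv , maximal) with g zero ≤? g (suc v)
...   | yes g₀≤gv = inj₂ (suc v , b<gv , λ { zero → g₀≤gv ; (suc x) → maximal x })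
...   | no g₀≰gv  =
  inj₂ (zero , <-trans b<gv (≰⇒> g₀≰gv) , λ { zero → ≤-refl ; (suc x) → ≤-trans (maximal x) (<⇒≤ (≰⇒> g₀≰gv)) })

colourCount≤ : ∀ {c M i ℓ} → c ≤ M → suc i ≤ ℓ → c + i * (ℓ * suc M + ℓ * suc M) ≤ 2 * (ℓ * ℓ) * (M + 1)
colourCount≤ {c} {M} {i} {suc l} c≤M i<ℓ = begin
  c + i * X      ≤⟨ +-monoˡ-≤ (i * X) (m≤n⇒m≤1+n c≤M) ⟩
  suc M + i * X  ≤⟨ +-monoˡ-≤ (i * X) (≤-trans (m≤n*m (suc M) (suc l)) (m≤m+n _ _)) ⟩
  suc i * X      ≤⟨ *-monoˡ-≤ X i<ℓ ⟩
  suc l * X      ≡⟨ expand (suc l) M ⟩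
  2 * (suc l * suc l) * (M + 1) ∎
  where
  open ≤-Reasoning
  open +-*-Solver
  X = suc l * suc M + suc l * suc M
  expand : ∀ ℓ M → ℓ * (ℓ * suc M + ℓ * suc M) ≡ 2 * (ℓ * ℓ) * (M + 1)
  expand = solve 2 (λ ℓ M → ℓ :* (ℓ :* (con 1 :+ M) :+ ℓ :* (con 1 :+ M)) := con 2 :* (ℓ :* ℓ) :* (M :+ con 1)) refl

ReducedSubgraph : Graph n → (ℓ χG ωG : ℕ) → Set
ReducedSubgraph {n} G ℓ χG ωG =
  Σ ℕ λ m → Σ (Fin m → Fin n) λ f → Injective _≡_ _≡_ f ×
    Σ ℕ λ χH → IsChromaticNumber (induced G f) χH × χG ≤ 2 * (ℓ * ℓ) * (χH + 1) ×
      (Σ ℕ (λ ωH → IsCliqueNumber (induced G f) ωH × ωH < ωG) ⊎ ¬ HasInducedKll (induced G f) ℓ)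

module Greedy {n} (G : Graph n) (ℓ : ℕ) {χG ωG : ℕ} (isχ : IsChromaticNumber G χG) (isω : IsCliqueNumber G ωG) where

  nbhd : ∀ v → Enumeration (Nbhd G v)
  nbhd v = enumerate (edge? G v)

  chromatic-nbhd : ∀ v → Σ ℕ (IsChromaticNumber (induced G (elem (nbhd v))))
  chromatic-nbhd v = chromaticNumber (induced G (elem (nbhd v)))

  χ-nbhd : Fin n → ℕ
  χ-nbhd v = proj₁ (chromatic-nbhd v)

  module Step {i} (copy : Fin i → Side ℓ → Fin n) where

    remote : Enumeration (∁ (Covered G copy))
    remote = enumerate (∁? (covered? G copy))

    chromatic-remote : Σ ℕ (IsChromaticNumber (induced G (elem remote)))
    chromatic-remote = chromaticNumber (induced G (elem remote))

    χ-remote : ℕ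
    χ-remote = proj₁ chromatic-remote

    χG≤ : ∀ {K} → (∀ v → χ-nbhd v ≤ K) → χG ≤ χ-remote + i * (ℓ * suc K + ℓ * suc K)
    χG≤ bounded = proj₂ isχ _ (colorable-∁∪ G (covered? G copy)
      (colorableOn-enumeration G remote (proj₁ (proj₂ chromatic-remote)))
      (colorableOn-⋃ G λ k → colorableOn-⋃⊎ G λ z → colorableOn-closedNbhd G (colorableOn-nbhd (copy k z))))
      where
      colorableOn-nbhd : ∀ v → ColorableOn G (Nbhd G v) _
      colorableOn-nbhd v = colorableOn-≤ G (bounded v)
        (colorableOn-enumeration G (nbhd v) (proj₁ (proj₂ (chromatic-nbhd v))))

    reduced : suc i ≤ ℓ → ¬ HasInducedKll (induced G (elem remote)) ℓ → ReducedSubgraph G ℓ χG ωG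
    reduced i<ℓ noKll = [ viaRemote , viaNbhd ]′ (bounded⊎argmax χ-nbhd (χ-remote))
      where
      viaRemote : (∀ v → χ-nbhd v ≤ χ-remote) → ReducedSubgraph G ℓ χG ωG
      viaRemote bounded =
        size remote , elem remote , elem-injective remote , χ-remote , proj₂ chromatic-remote ,
        ≤-trans (χG≤ bounded) (colourCount≤ ≤-refl i<ℓ) , inj₂ noKll
      viaNbhd : ∃[ v ] χ-remote < χ-nbhd v × (∀ x → χ-nbhd x ≤ χ-nbhd v) → ReducedSubgraph G ℓ χG ωG
      viaNbhd (v , χ-remote<χv , maximal) =
        size (nbhd v) , elem (nbhd v) , elem-injective (nbhd v) , χ-nbhd v , proj₂ (chromatic-nbhd v) ,
        ≤-trans (χG≤ maximal) (colourCount≤ (<⇒≤ χ-remote<χv) i<ℓ) ,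
        inj₁ (proj₁ ωH , proj₂ ωH , cliqueNumber-nbhd< G isω (nbhd v) (proj₂ ωH))
        where
        ωH = cliqueNumber (induced G (elem (nbhd v)))

  extend : suc i ≤ ℓ → SeparatedKlls G ℓ i → SeparatedKlls G ℓ (suc i) ⊎ ReducedSubgraph G ℓ χG ωG
  extend i<ℓ s@(copy , _) = extendBy (hasInducedKll? (induced G (elem remote)) ℓ)
    where
    open Step copy
    extendBy : Dec (HasInducedKll (induced G (elem remote)) ℓ) → SeparatedKlls G ℓ (suc _) ⊎ ReducedSubgraph G ℓ χG ωG
    extendBy (yes (a , a-kll)) =
      inj₁ (separatedKlls-extend G s (isInducedKll-induced G (elem-injective remote) a-kll) (elem∈ remote ∘ a))
    extendBy (no noKll) = inj₂ (reduced i<ℓ noKll)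

  separated⊎reduced : ∀ i → i ≤ ℓ → SeparatedKlls G ℓ i ⊎ ReducedSubgraph G ℓ χG ωG
  separated⊎reduced zero    _   = inj₁ ((λ ()) , (λ ()) , λ ())
  separated⊎reduced (suc i) i<ℓ = [ extend i<ℓ , inj₂ ]′ (separated⊎reduced i (<⇒≤ i<ℓ))

-- For ℓ = 0 the first alternative holds vacuously.
lemma6p2 : (ℓ : ℕ) → 1 ≤ ℓ → {n : ℕ} (G : Graph n) (χG ωG : ℕ) →
    IsChromaticNumber G χG → IsCliqueNumber G ωG →
    HasSeparatedKlls G ℓ
    ⊎ Σ ℕ (λ m → Σ (Fin m → Fin n) (λ f → Injective _≡_ _≡_ f ×
        Σ ℕ (λ χH → IsChromaticNumber (induced G f) χH ×
          χG ≤ 2 * (ℓ * ℓ) * (χH + 1) ×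
          (Σ ℕ (λ ωH → IsCliqueNumber (induced G f) ωH × ωH < ωG)
           ⊎ ¬ HasInducedKll (induced G f) ℓ))))
lemma6p2 ℓ _ G _ _ isχ isω = Greedy.separated⊎reduced G ℓ isχ isω ℓ ≤-refl
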